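{- Let $r$ be a positive integer, $k\in\mathbb Z$, and $a_1,\dots,a_r$ nonzero complex numbers. Then for every integer $n\ge 0$, \begin{align*} S_n^{(r,k)}(x|a_1,\dots,a_r)&=\sum_{l=0}^n\binom{n}{l}B_{n-l}(a_1,\dots,a_r)B_l^{(k)}(x)\\ &=\sum_{l=0}^n\binom{n}{l}B_{n-l}^{(k)}B_l(x|a_1,\dots,a_r)\\ &=\sum_{l=0}^n\sum_{m=0}^n\sum_{j=0}^m(-1)^j\binom{m}{j}\binom{n}{l}\frac{1}{(m+1)^k}B_{n-l}(a_1,\dots,a_r)(x-j)^l\\ &=\sum_{l=0}^n\left(\sum_{j=l}^n\sum_{m=0}^{n-j}(-1)^{n-m-j}\binom{n}{j}\binom{j}{l}\frac{m!}{(m+1)^k}S_2(n-j,m)B_{j-l}(a_1,\dots,a_r)\right)x^l\\ &=\sum_{j=0}^n\binom{n}{j}S_{n-j}^{(r,k)}(a_1,\dots,a_r)x^j. \end{align*}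
   Context: For an integer $k$, ${\rm Li}_k(x)=\sum_{m=1}^\infty x^m/m^k$ is the $k$th polylogarithm. For $r\in\mathbb Z_{>0}$, $k\in\mathbb Z$ and nonzero complex $a_1,\dots,a_r$, the Barnes' multiple Bernoulli and poly-Bernoulli mixed-type polynomials $S_n^{(r,k)}(x|a_1,\dots,a_r)$ are defined by $\frac{t^r}{\prod_{j=1}^r(e^{a_jt}-1)}\frac{{\rm Li}_k(1-e^{ -t})}{1-e^{ -t}}e^{xt}=\sum_{n\ge0}S_n^{(r,k)}(x|a_1,\dots,a_r)\frac{t^n}{n!}$, and $S_n^{(r,k)}(a_1,\dots,a_r):=S_n^{(r,k)}(0|a_1,\dots,a_r)$. The poly-Bernoulli polynomials are defined by $\frac{{\rm Li}_k(1-e^{ -t})}{1-e^{ -t}}e^{xt}=\sum_{n\ge0}B_n^{(k)}(x)\frac{t^n}{n!}$, with $B_n^{(k)}:=B_n^{(k)}(0)$. The Barnes' multiple Bernoulli polynomials are defined by $\frac{t^r}{\prod_{j=1}^r(e^{a_jt}-1)}e^{xt}=\sum_{n\ge0}B_n(x|a_1,\dots,a_r)\frac{t^n}{n!}$, with $B_n(a_1,\dots,a_r):=B_n(0|a_1,\dots,a_r)$. $S_2(l,m)$ are the Stirling numbers of the second kind: $(e^t-1)^m=m!\sum_{l\ge m}S_2(l,m)\frac{t^l}{l!}$. -}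

module Defs where

open import Level using (Level; _⊔_) renaming (suc to lsuc)
open import Algebra.Bundles using (CommutativeRing)
open import Data.Nat as ℕ using (ℕ; zero; suc; _∸_; _!; _≤?_)
open import Data.Nat.Combinatorics using (_C_)
open import Data.Integer as ℤ using (ℤ; +_; -[1+_])
open import Data.Bool using (if_then_else_)
open import Data.Vec using (Vec; []; _∷_)
open import Relation.Nullary using (¬_; does)

natToR : ∀ {c ℓ} (R : CommutativeRing c ℓ) → ℕ → CommutativeRing.Carrier R
natToR R zero = CommutativeRing.0# R
natToR R (suc n) = CommutativeRing._+_ R (CommutativeRing.1# R) (natToR R n)

-- A field of characteristic zero (the paper works over ℂ, which is such a field).
-- The inverse is a total operation, specified only on nonzero elements.
record CharZeroField (c ℓ : Level) : Set (lsuc (c ⊔ ℓ)) where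
  field
    commutativeRing : CommutativeRing c ℓ
  open CommutativeRing commutativeRing public
  field
    _⁻¹      : Carrier → Carrier
    inverseʳ : ∀ x → ¬ (x ≈ 0#) → (x * (x ⁻¹)) ≈ 1#
    charZero : ∀ n → ¬ (natToR commutativeRing (suc n) ≈ 0#)

module Series {c ℓ : Level} (F : CharZeroField c ℓ) where
  open CharZeroField F

  ι : ℕ → Carrier
  ι = natToR commutativeRing

  ιℤ : ℤ → Carrier
  ιℤ (+ n) = ι n
  ιℤ -[1+ n ] = - ι (suc n)

  _^_ : Carrier → ℕ → Carrier
  x ^ zero = 1#
  x ^ suc n = x * (x ^ n)

  _^ℤ_ : Carrier → ℤ → Carrier
  x ^ℤ (+ n) = x ^ n
  x ^ℤ -[1+ n ] = (x ^ suc n) ⁻¹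

  sumCount : ℕ → ℕ → (ℕ → Carrier) → Carrier
  sumCount s zero f = 0#
  sumCount s (suc c) f = f s + sumCount (suc s) c f

  -- Σ_{i=l}^{n} f i   (empty if n < l)
  Σ[_⋯_] : ℕ → ℕ → (ℕ → Carrier) → Carrier
  Σ[ l ⋯ n ] f = sumCount l (suc n ∸ l) f

  PowerSeries : Set c
  PowerSeries = ℕ → Carrier

  oneS : PowerSeries
  oneS zero = 1#
  oneS (suc n) = 0#

  _⊛_ : PowerSeries → PowerSeries → PowerSeries
  (f ⊛ g) n = Σ[ 0 ⋯ n ] (λ i → f i * g (n ∸ i))

  _⊝_ : PowerSeries → PowerSeries → PowerSeries
  (f ⊝ g) n = f n - g n

  powS : PowerSeries → ℕ → PowerSeries
  powS f zero = oneS
  powS f (suc m) = f ⊛ powS f m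

  expS : Carrier → PowerSeries
  expS a n = (a ^ n) * ((ι (n !)) ⁻¹)

  -- multiplicative inverse of a power series (with invertible constant term):
  -- b 0 = c 0 ⁻¹,  b n = - c 0 ⁻¹ * Σ_{i=1}^{n} c i * b (n - i)
  invUpTo : PowerSeries → ℕ → (ℕ → Carrier)
  invUpTo f zero = λ _ → f 0 ⁻¹
  invUpTo f (suc n) m =
    if does (m ≤? n) then invUpTo f n m
    else (- (f 0 ⁻¹)) * Σ[ 1 ⋯ suc n ] (λ i → f i * invUpTo f n (suc n ∸ i))

  invS : PowerSeries → PowerSeries
  invS f n = invUpTo f n n

  -- (e^{a t} - 1)/t = Σ a^{n+1} t^n / (n+1)!
  expMinusOneOverT : Carrier → PowerSeries
  expMinusOneOverT a n = expS a (suc n)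

  barnesFactor : Carrier → PowerSeries
  barnesFactor a = invS (expMinusOneOverT a)

  -- t^r / ∏_{j=1}^r (e^{a_j t} - 1) = ∏_j t/(e^{a_j t} - 1)
  barnesGF : ∀ {r} → Vec Carrier r → PowerSeries
  barnesGF [] = oneS
  barnesGF (a ∷ as) = barnesFactor a ⊛ barnesGF as

  uS : PowerSeries
  uS = oneS ⊝ expS (- 1#)

  -- Li_k(u)/u = Σ_{m≥0} u^m / (m+1)^k, composed with u = 1 - e^{-t}.
  -- Since u^m = O(t^m), only m ≤ n contributes to the coefficient of t^n.
  polyLiGF : ℤ → PowerSeries
  polyLiGF k n = Σ[ 0 ⋯ n ] (λ m → ((ι (suc m)) ^ℤ (ℤ.- k)) * powS uS m n)

  egfCoeff : PowerSeries → ℕ → Carrier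
  egfCoeff f n = ι (n !) * f n

  S[_,_] : ∀ {r} → Vec Carrier r → ℤ → Carrier → ℕ → Carrier
  S[ as , k ] x n = egfCoeff ((barnesGF as ⊛ polyLiGF k) ⊛ expS x) n

  S0[_,_] : ∀ {r} → Vec Carrier r → ℤ → ℕ → Carrier
  S0[ as , k ] n = S[ as , k ] 0# n

  polyB : ℤ → Carrier → ℕ → Carrier
  polyB k x n = egfCoeff (polyLiGF k ⊛ expS x) n

  polyB0 : ℤ → ℕ → Carrier
  polyB0 k n = polyB k 0# n

  barnesB : ∀ {r} → Vec Carrier r → Carrier → ℕ → Carrier
  barnesB as x n = egfCoeff (barnesGF as ⊛ expS x) n

  barnesB0 : ∀ {r} → Vec Carrier r → ℕ → Carrier
  barnesB0 as n = barnesB as 0# n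

  -- Stirling numbers of the second kind (as field elements), via
  -- (e^t - 1)^m = m! Σ_{l≥m} S₂(l,m) t^l / l!
  S₂ : ℕ → ℕ → Carrier
  S₂ l m = (ι (m !) ⁻¹) * (ι (l !) * powS (expS 1# ⊝ oneS) m l)

  binom : ℕ → ℕ → Carrier
  binom n k = ι (n C k)

-- Every expression of the theorem is n! times the coefficient of t^n of a product of
-- exponential generating functions, so the first, second and fifth identities are the
-- binomial convolution of egf coefficients applied to different bracketings of
-- (t^r / ∏ (e^{a_j t} - 1)) · (Li_k(u) / u) · e^{x t}, with u = 1 - e^{-t}.  For the
-- other two one expands Li_k(u)/u = Σ_m u^m / (m+1)^k: the egf coefficients of
-- u^m e^{x t} are the backward differences Σ_j (-1)^j C(m,j) (x-j)^l, while those of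
-- u^m alone are (-1)^(l-m) m! S₂(l,m), because u^m(t) = (-1)^m (e^{-t} - 1)^m.
{-# OPTIONS --safe #-}
module Submission where

open import Defs
open import Data.Nat as ℕ using (ℕ; zero; suc; _∸_; _!; z≤n; s≤s)
open import Data.Nat.Properties as ℕ using (_!*_!≢0)
open import Data.Nat.Combinatorics using (_C_; k![n∸k]!∣n!; nCk+nC[k+1]≡[n+1]C[k+1])
open import Data.Nat.Combinatorics.Specification using (nCk≡n!/k![n-k]!; k>n⇒nCk≡0)
open import Data.Nat.DivMod using (m/n*n≡m)
open import Data.Integer using (ℤ) renaming (-_ to negℤ)
open import Data.Vec using (Vec; lookup)
open import Data.Product using (_×_; _,_)
open import Relation.Nullary using (¬_; yes; no)
open import Relation.Binary.PropositionalEquality as ≡ using (_≡_)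
import Algebra.Properties.Ring as RingProperties
import Algebra.Solver.CommutativeMonoid as CommutativeMonoidSolver

module SeriesIdentities {c ℓ} (F : CharZeroField c ℓ) where
  open CharZeroField F
  open Series F
  open RingProperties ring using (-1*x≈-x; -‿distribˡ-*; -‿distribʳ-*; -‿involutive; -0#≈0#; -‿+-comm)
  open import Relation.Binary.Reasoning.Setoid setoid
  module +-Solver = CommutativeMonoidSolver +-commutativeMonoid
  module *-Solver = CommutativeMonoidSolver *-commutativeMonoid
  open *-Solver using (solve; _⊜_; _⊕_)

  ≡⇒≈ : ∀ {a b} → a ≡ b → a ≈ b
  ≡⇒≈ ≡.refl = refl

  -- Finite sums

  sumCount-cong-< : ∀ s n {f g : ℕ → Carrier} → (∀ i → s ℕ.≤ i → i ℕ.< s ℕ.+ n → f i ≈ g i) →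
                    sumCount s n f ≈ sumCount s n g
  sumCount-cong-< s zero h = refl
  sumCount-cong-< s (suc n) h =
    +-cong (h s ℕ.≤-refl (≡.subst (s ℕ.<_) (≡.sym (ℕ.+-suc s n)) (s≤s (ℕ.m≤m+n s n))))
           (sumCount-cong-< (suc s) n (λ i s<i i< → h i (ℕ.<⇒≤ s<i) (≡.subst (i ℕ.<_) (≡.sym (ℕ.+-suc s n)) i<)))

  sumCount-cong : ∀ s n {f g : ℕ → Carrier} → (∀ i → f i ≈ g i) → sumCount s n f ≈ sumCount s n g
  sumCount-cong s n h = sumCount-cong-< s n (λ i _ _ → h i)

  sumCount-zero : ∀ s n → sumCount s n (λ _ → 0#) ≈ 0#
  sumCount-zero s zero = refl
  sumCount-zero s (suc n) = trans (+-identityˡ _) (sumCount-zero (suc s) n)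

  sumCount-+ : ∀ s n (f g : ℕ → Carrier) →
               sumCount s n (λ i → f i + g i) ≈ sumCount s n f + sumCount s n g
  sumCount-+ s zero f g = sym (+-identityˡ 0#)
  sumCount-+ s (suc n) f g = trans (+-congˡ (sumCount-+ (suc s) n f g))
    (+-Solver.solve 4 (λ a b c d → (a ⊕' b) ⊕' (c ⊕' d) ⊜' (a ⊕' c) ⊕' (b ⊕' d)) refl (f s) (g s) _ _)
    where open +-Solver using () renaming (_⊕_ to _⊕'_; _⊜_ to _⊜'_)

  *-distribˡ-sumCount : ∀ s n a (f : ℕ → Carrier) → a * sumCount s n f ≈ sumCount s n (λ i → a * f i)
  *-distribˡ-sumCount s zero a f = zeroʳ a
  *-distribˡ-sumCount s (suc n) a f = trans (distribˡ a _ _) (+-congˡ (*-distribˡ-sumCount (suc s) n a f))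

  *-distribʳ-sumCount : ∀ s n a (f : ℕ → Carrier) → sumCount s n f * a ≈ sumCount s n (λ i → f i * a)
  *-distribʳ-sumCount s n a f =
    trans (*-comm _ a) (trans (*-distribˡ-sumCount s n a f) (sumCount-cong s n (λ i → *-comm a (f i))))

  sumCount-- : ∀ s n (f g : ℕ → Carrier) →
               sumCount s n (λ i → f i - g i) ≈ sumCount s n f - sumCount s n g
  sumCount-- s n f g = trans (sumCount-+ s n f (λ i → - g i)) (+-congˡ (sym -‿sumCount))
    where
    -‿sumCount : - sumCount s n g ≈ sumCount s n (λ i → - g i)
    -‿sumCount = trans (sym (-1*x≈-x _))
      (trans (*-distribˡ-sumCount s n (- 1#) g) (sumCount-cong s n (λ i → -1*x≈-x (g i))))

  sumCount-suc : ∀ s n (f : ℕ → Carrier) → sumCount (suc s) n f ≡ sumCount s n (λ i → f (suc i))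
  sumCount-suc s zero f = ≡.refl
  sumCount-suc s (suc n) f = ≡.cong (f (suc s) +_) (sumCount-suc (suc s) n f)

  sumCount-shift : ∀ t s n (f : ℕ → Carrier) → sumCount (t ℕ.+ s) n f ≡ sumCount s n (λ i → f (t ℕ.+ i))
  sumCount-shift zero s n f = ≡.refl
  sumCount-shift (suc t) s n f = ≡.trans (sumCount-suc (t ℕ.+ s) n f) (sumCount-shift t s n (λ i → f (suc i)))

  sumCount-snoc : ∀ s n (f : ℕ → Carrier) → sumCount s (suc n) f ≈ sumCount s n f + f (s ℕ.+ n)
  sumCount-snoc s zero f =
    trans (+-identityʳ _) (trans (≡⇒≈ (≡.cong f (≡.sym (ℕ.+-identityʳ s)))) (sym (+-identityˡ _)))
  sumCount-snoc s (suc n) f = trans (+-congˡ (sumCount-snoc (suc s) n f))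
    (trans (sym (+-assoc _ _ _)) (+-congˡ (≡⇒≈ (≡.cong f (≡.sym (ℕ.+-suc s n))))))

  sumCount-split : ∀ s a b (f : ℕ → Carrier) →
                   sumCount s (a ℕ.+ b) f ≈ sumCount s a f + sumCount (s ℕ.+ a) b f
  sumCount-split s zero b f =
    trans (≡⇒≈ (≡.cong (λ t → sumCount t b f) (≡.sym (ℕ.+-identityʳ s)))) (sym (+-identityˡ _))
  sumCount-split s (suc a) b f = trans (+-congˡ (sumCount-split (suc s) a b f))
    (trans (sym (+-assoc _ _ _)) (+-congˡ (≡⇒≈ (≡.cong (λ t → sumCount t b f) (≡.sym (ℕ.+-suc s a))))))

  sumCount-swap : ∀ s a t b (f : ℕ → ℕ → Carrier) →
                  sumCount s a (λ i → sumCount t b (f i)) ≈ sumCount t b (λ j → sumCount s a (λ i → f i j))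
  sumCount-swap s zero t b f = sym (sumCount-zero t b)
  sumCount-swap s (suc a) t b f =
    trans (+-congˡ (sumCount-swap (suc s) a t b f)) (sym (sumCount-+ t b (f s) _))

  Σ-reverse : ∀ n (f : ℕ → Carrier) → Σ[ 0 ⋯ n ] f ≈ Σ[ 0 ⋯ n ] (λ i → f (n ∸ i))
  Σ-reverse zero f = refl
  Σ-reverse (suc n) f = begin
      f 0 + sumCount 1 (suc n) f
    ≡⟨ ≡.cong (f 0 +_) (sumCount-suc 0 (suc n) f) ⟩
      f 0 + Σ[ 0 ⋯ n ] (λ i → f (suc i))
    ≈⟨ +-congˡ (Σ-reverse n (λ i → f (suc i))) ⟩
      f 0 + Σ[ 0 ⋯ n ] (λ i → f (suc (n ∸ i)))
    ≈⟨ +-congˡ (sumCount-cong-< 0 (suc n) (λ i _ i< → ≡⇒≈ (≡.cong f (≡.sym (ℕ.+-∸-assoc 1 (ℕ.≤-pred i<)))))) ⟩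
      f 0 + Σ[ 0 ⋯ n ] (λ i → f (suc n ∸ i))
    ≈⟨ +-comm _ _ ⟩
      Σ[ 0 ⋯ n ] (λ i → f (suc n ∸ i)) + f 0
    ≈⟨ +-congˡ (≡⇒≈ (≡.cong f (≡.sym (ℕ.n∸n≡0 (suc n))))) ⟩
      Σ[ 0 ⋯ n ] (λ i → f (suc n ∸ i)) + f (suc n ∸ suc n)
    ≈⟨ sym (sumCount-snoc 0 (suc n) (λ i → f (suc n ∸ i))) ⟩
      Σ[ 0 ⋯ suc n ] (λ i → f (suc n ∸ i))
    ∎

  Σ-cong-≤ : ∀ l n {f g : ℕ → Carrier} → (∀ i → l ℕ.≤ i → i ℕ.≤ n → f i ≈ g i) → Σ[ l ⋯ n ] f ≈ Σ[ l ⋯ n ] g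
  Σ-cong-≤ l n h with l ℕ.≤? suc n
  ... | yes l≤ = sumCount-cong-< l (suc n ∸ l)
                   (λ i l≤i i< → h i l≤i (ℕ.≤-pred (≡.subst (i ℕ.<_) (ℕ.m+[n∸m]≡n l≤) i<)))
  ... | no l≰ rewrite ℕ.m≤n⇒m∸n≡0 (ℕ.<⇒≤ (ℕ.≰⇒> l≰)) = refl

  Σ-snoc : ∀ l n (f : ℕ → Carrier) → l ℕ.≤ suc n → Σ[ l ⋯ suc n ] f ≈ Σ[ l ⋯ n ] f + f (suc n)
  Σ-snoc l n f l≤ rewrite ℕ.+-∸-assoc 1 l≤ =
    trans (sumCount-snoc l (suc n ∸ l) f) (+-congˡ (≡⇒≈ (≡.cong f (ℕ.m+[n∸m]≡n l≤))))

  Σ-from-zero : ∀ a n (g : ℕ → Carrier) → a ℕ.≤ n → Σ[ a ⋯ n ] g ≈ Σ[ 0 ⋯ n ∸ a ] (λ b → g (a ℕ.+ b))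
  Σ-from-zero a n g a≤ rewrite ℕ.+-∸-assoc 1 a≤ =
    ≡⇒≈ (≡.trans (≡.cong (λ t → sumCount t (suc (n ∸ a)) g) (≡.sym (ℕ.+-identityʳ a)))
                 (sumCount-shift a 0 (suc (n ∸ a)) g))

  Σ-triangle : ∀ n (f : ℕ → ℕ → Carrier) →
               Σ[ 0 ⋯ n ] (λ i → Σ[ 0 ⋯ i ] (f i)) ≈ Σ[ 0 ⋯ n ] (λ j → Σ[ j ⋯ n ] (λ i → f i j))
  Σ-triangle zero f = refl
  Σ-triangle (suc n) f = begin
      Σ[ 0 ⋯ suc n ] (λ i → Σ[ 0 ⋯ i ] (f i))
    ≈⟨ sumCount-snoc 0 (suc n) _ ⟩
      Σ[ 0 ⋯ n ] (λ i → Σ[ 0 ⋯ i ] (f i)) + Σ[ 0 ⋯ suc n ] (f (suc n))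
    ≈⟨ +-congʳ (Σ-triangle n f) ⟩
      Σ[ 0 ⋯ n ] (λ j → Σ[ j ⋯ n ] (λ i → f i j)) + Σ[ 0 ⋯ suc n ] (f (suc n))
    ≈⟨ +-congʳ (sym (trans (sumCount-snoc 0 (suc n) _) (trans (+-congˡ emptyColumn) (+-identityʳ _)))) ⟩
      Σ[ 0 ⋯ suc n ] (λ j → Σ[ j ⋯ n ] (λ i → f i j)) + Σ[ 0 ⋯ suc n ] (f (suc n))
    ≈⟨ sym (sumCount-+ 0 (suc (suc n)) _ _) ⟩
      Σ[ 0 ⋯ suc n ] (λ j → Σ[ j ⋯ n ] (λ i → f i j) + f (suc n) j)
    ≈⟨ Σ-cong-≤ 0 (suc n) (λ j _ j≤ → sym (Σ-snoc j n (λ i → f i j) j≤)) ⟩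
      Σ[ 0 ⋯ suc n ] (λ j → Σ[ j ⋯ suc n ] (λ i → f i j))
    ∎
    where
    emptyColumn : Σ[ suc n ⋯ n ] (λ i → f i (suc n)) ≈ 0#
    emptyColumn = ≡⇒≈ (≡.cong (λ t → sumCount (suc n) t (λ i → f i (suc n))) (ℕ.n∸n≡0 n))

  Σ-pad : ∀ i n (g : ℕ → Carrier) → i ℕ.≤ n → (∀ m → i ℕ.< m → m ℕ.≤ n → g m ≈ 0#) →
          Σ[ 0 ⋯ i ] g ≈ Σ[ 0 ⋯ n ] g
  Σ-pad i n g i≤n g≈0 = begin
      sumCount 0 (suc i) g
    ≈⟨ sym (+-identityʳ _) ⟩
      sumCount 0 (suc i) g + 0#
    ≈⟨ +-congˡ (sym (trans (sumCount-cong-< (suc i) (n ∸ i) tail≈0) (sumCount-zero (suc i) (n ∸ i)))) ⟩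
      sumCount 0 (suc i) g + sumCount (suc i) (n ∸ i) g
    ≈⟨ sym (sumCount-split 0 (suc i) (n ∸ i) g) ⟩
      sumCount 0 (suc i ℕ.+ (n ∸ i)) g
    ≡⟨ ≡.cong (λ t → sumCount 0 t g) length≡ ⟩
      sumCount 0 (suc n) g
    ∎
    where
    length≡ : suc i ℕ.+ (n ∸ i) ≡ suc n
    length≡ = ≡.cong suc (ℕ.m+[n∸m]≡n i≤n)
    tail≈0 : ∀ m → suc i ℕ.≤ m → m ℕ.< suc i ℕ.+ (n ∸ i) → g m ≈ 0#
    tail≈0 m i<m m< = g≈0 m i<m (ℕ.≤-pred (≡.subst (m ℕ.<_) length≡ m<))

  ι-+ : ∀ a b → ι (a ℕ.+ b) ≈ ι a + ι b
  ι-+ zero b = sym (+-identityˡ _)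
  ι-+ (suc a) b = trans (+-congˡ (ι-+ a b)) (sym (+-assoc _ _ _))

  ι-* : ∀ a b → ι (a ℕ.* b) ≈ ι a * ι b
  ι-* zero b = sym (zeroˡ _)
  ι-* (suc a) b = trans (ι-+ b (a ℕ.* b)) (trans (+-congˡ (ι-* a b))
    (trans (+-congʳ (sym (*-identityˡ (ι b)))) (sym (distribʳ (ι b) 1# (ι a)))))

  ι-1 : ι 1 ≈ 1#
  ι-1 = +-identityʳ 1#

  ι-inverseʳ : ∀ m → 1 ℕ.≤ m → ι m * (ι m ⁻¹) ≈ 1#
  ι-inverseʳ (suc m) _ = inverseʳ _ (charZero m)

  ι-1⁻¹ : ι 1 ⁻¹ ≈ 1#
  ι-1⁻¹ = trans (sym (*-identityˡ _)) (trans (*-congʳ (sym ι-1)) (ι-inverseʳ 1 (s≤s z≤n)))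

  ι!-cancelˡ : ∀ n a → ι (n !) * (a * ι (n !) ⁻¹) ≈ a
  ι!-cancelˡ n a = trans (solve 3 (λ p b q → p ⊕ (b ⊕ q) ⊜ b ⊕ (p ⊕ q)) refl (ι (n !)) a _)
    (trans (*-congˡ (ι-inverseʳ (n !) (ℕ.1≤n! n))) (*-identityʳ a))

  k>n⇒binom≈0 : ∀ n k → n ℕ.< k → binom n k ≈ 0#
  k>n⇒binom≈0 n k n<k = ≡⇒≈ (≡.cong ι (k>n⇒nCk≡0 n<k))

  binom-pascal : ∀ n k → binom (suc n) (suc k) ≈ binom n k + binom n (suc k)
  binom-pascal n k =
    trans (≡⇒≈ (≡.cong ι (≡.sym (nCk+nC[k+1]≡[n+1]C[k+1] n k)))) (ι-+ (n C k) (n C suc k))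

  ι!-split : ∀ n l → l ℕ.≤ n → ι (n !) ≈ binom n l * (ι (l !) * ι ((n ∸ l) !))
  ι!-split n l l≤n = trans (≡⇒≈ (≡.cong ι n!≡))
    (trans (ι-* (n C l) (l ! ℕ.* (n ∸ l) !)) (*-congˡ (ι-* (l !) ((n ∸ l) !))))
    where
    n!≡ : n ! ≡ (n C l) ℕ.* (l ! ℕ.* (n ∸ l) !)
    n!≡ = ≡.sym (≡.trans (≡.cong (ℕ._* (l ! ℕ.* (n ∸ l) !)) (nCk≡n!/k![n-k]! l≤n))
                         (m/n*n≡m {{l !* (n ∸ l) !≢0}} (k![n∸k]!∣n! l≤n)))

  ^-cong : ∀ {a b} n → a ≈ b → a ^ n ≈ b ^ n
  ^-cong zero a≈b = refl
  ^-cong (suc n) a≈b = *-cong a≈b (^-cong n a≈b)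

  ^-distribˡ-+-* : ∀ y a b → y ^ (a ℕ.+ b) ≈ y ^ a * y ^ b
  ^-distribˡ-+-* y zero b = sym (*-identityˡ _)
  ^-distribˡ-+-* y (suc a) b = trans (*-congˡ (^-distribˡ-+-* y a b)) (sym (*-assoc _ _ _))

  1^n≈1 : ∀ n → 1# ^ n ≈ 1#
  1^n≈1 zero = refl
  1^n≈1 (suc n) = trans (*-identityˡ _) (1^n≈1 n)

  [-1]^n*[-1]^n≈1 : ∀ n → (- 1#) ^ n * (- 1#) ^ n ≈ 1#
  [-1]^n*[-1]^n≈1 zero = *-identityˡ 1#
  [-1]^n*[-1]^n≈1 (suc n) =
    trans (solve 2 (λ m p → (m ⊕ p) ⊕ (m ⊕ p) ⊜ (m ⊕ m) ⊕ (p ⊕ p)) refl (- 1#) ((- 1#) ^ n))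
          (trans (*-cong [-1]*[-1]≈1 ([-1]^n*[-1]^n≈1 n)) (*-identityˡ 1#))
    where
    [-1]*[-1]≈1 : (- 1#) * (- 1#) ≈ 1#
    [-1]*[-1]≈1 = trans (-1*x≈-x (- 1#)) (-‿involutive 1#)

  [-1]^a*[-1]^[n∸a] : ∀ a n → a ℕ.≤ n → (- 1#) ^ a * (- 1#) ^ (n ∸ a) ≈ (- 1#) ^ n
  [-1]^a*[-1]^[n∸a] a n a≤n =
    trans (sym (^-distribˡ-+-* (- 1#) a (n ∸ a))) (≡⇒≈ (≡.cong ((- 1#) ^_) (ℕ.m+[n∸m]≡n a≤n)))

  binomial-pascal : ∀ l (A : ℕ → Carrier) →
    Σ[ 0 ⋯ suc l ] (λ i → binom (suc l) i * A i) ≈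
      Σ[ 0 ⋯ l ] (λ i → binom l i * A i) + Σ[ 0 ⋯ l ] (λ i → binom l i * A (suc i))
  binomial-pascal l A = begin
      binom l 0 * A 0 + sumCount 1 (suc l) (λ i → binom (suc l) i * A i)
    ≡⟨ ≡.cong (binom l 0 * A 0 +_) (sumCount-suc 0 (suc l) _) ⟩
      binom l 0 * A 0 + sumCount 0 (suc l) (λ i → binom (suc l) (suc i) * A (suc i))
    ≈⟨ +-congˡ (sumCount-cong 0 (suc l) (λ i → trans (*-congʳ (binom-pascal l i)) (distribʳ _ _ _))) ⟩
      binom l 0 * A 0 + sumCount 0 (suc l) (λ i → binom l i * A (suc i) + binom l (suc i) * A (suc i))
    ≈⟨ +-congˡ (sumCount-+ 0 (suc l) _ _) ⟩
      binom l 0 * A 0 + (shifted + sumCount 0 (suc l) (λ i → binom l (suc i) * A (suc i)))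
    ≈⟨ +-congˡ (+-congˡ (trans (sumCount-snoc 0 l _) (trans (+-congˡ lastTerm≈0) (+-identityʳ _)))) ⟩
      binom l 0 * A 0 + (shifted + sumCount 0 l (λ i → binom l (suc i) * A (suc i)))
    ≈⟨ +-Solver.solve 3 (λ a b c → a ⊕' (b ⊕' c) ⊜' (a ⊕' c) ⊕' b) refl _ shifted _ ⟩
      (binom l 0 * A 0 + sumCount 0 l (λ i → binom l (suc i) * A (suc i))) + shifted
    ≡⟨ ≡.cong (λ t → (binom l 0 * A 0 + t) + shifted) (≡.sym (sumCount-suc 0 l _)) ⟩
      Σ[ 0 ⋯ l ] (λ i → binom l i * A i) + shifted
    ∎
    where
    open +-Solver using () renaming (_⊕_ to _⊕'_; _⊜_ to _⊜'_)
    shifted = Σ[ 0 ⋯ l ] (λ i → binom l i * A (suc i))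
    lastTerm≈0 : binom l (suc l) * A (suc l) ≈ 0#
    lastTerm≈0 = trans (*-congʳ (k>n⇒binom≈0 l (suc l) ℕ.≤-refl)) (zeroˡ _)

  binomial-theorem : ∀ l y z → (y + z) ^ l ≈ Σ[ 0 ⋯ l ] (λ i → binom l i * (z ^ (l ∸ i) * y ^ i))
  binomial-theorem zero y z =
    sym (trans (+-identityʳ _) (trans (*-cong ι-1 (*-identityˡ 1#)) (*-identityˡ 1#)))
  binomial-theorem (suc l) y z = begin
      (y + z) * (y + z) ^ l
    ≈⟨ *-congˡ (binomial-theorem l y z) ⟩
      (y + z) * expansion
    ≈⟨ trans (distribʳ expansion y z) (+-comm _ _) ⟩
      z * expansion + y * expansion
    ≈⟨ +-cong (*-distribˡ-sumCount 0 (suc l) z _) (*-distribˡ-sumCount 0 (suc l) y _) ⟩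
      Σ[ 0 ⋯ l ] (λ i → z * (binom l i * (z ^ (l ∸ i) * y ^ i)))
        + Σ[ 0 ⋯ l ] (λ i → y * (binom l i * (z ^ (l ∸ i) * y ^ i)))
    ≈⟨ +-cong (sumCount-cong-< 0 (suc l) (λ i _ i< → trans
                 (solve 4 (λ z b Z Y → z ⊕ (b ⊕ (Z ⊕ Y)) ⊜ b ⊕ ((z ⊕ Z) ⊕ Y)) refl z (binom l i) (z ^ (l ∸ i)) (y ^ i))
                 (*-congˡ (*-congʳ (≡⇒≈ (≡.cong (z ^_) (≡.sym (ℕ.+-∸-assoc 1 (ℕ.≤-pred i<)))))))))
              (sumCount-cong 0 (suc l) (λ i →
                 solve 4 (λ y b Z Y → y ⊕ (b ⊕ (Z ⊕ Y)) ⊜ b ⊕ (Z ⊕ (y ⊕ Y))) refl y (binom l i) (z ^ (l ∸ i)) (y ^ i))) ⟩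
      Σ[ 0 ⋯ l ] (λ i → binom l i * (z ^ (suc l ∸ i) * y ^ i))
        + Σ[ 0 ⋯ l ] (λ i → binom l i * (z ^ (suc l ∸ suc i) * y ^ suc i))
    ≈⟨ sym (binomial-pascal l (λ i → z ^ (suc l ∸ i) * y ^ i)) ⟩
      Σ[ 0 ⋯ suc l ] (λ i → binom (suc l) i * (z ^ (suc l ∸ i) * y ^ i))
    ∎
    where expansion = Σ[ 0 ⋯ l ] (λ i → binom l i * (z ^ (l ∸ i) * y ^ i))

  -- Formal power series

  infix 4 _≋_
  _≋_ : PowerSeries → PowerSeries → Set ℓ
  f ≋ g = ∀ n → f n ≈ g n

  ≋-trans : ∀ {f g h} → f ≋ g → g ≋ h → f ≋ h
  ≋-trans f≋g g≋h n = trans (f≋g n) (g≋h n)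

  ⊛-cong : ∀ {f f′ g g′} → f ≋ f′ → g ≋ g′ → f ⊛ g ≋ f′ ⊛ g′
  ⊛-cong f≋f′ g≋g′ n = sumCount-cong 0 (suc n) (λ i → *-cong (f≋f′ i) (g≋g′ (n ∸ i)))

  ⊛-comm : ∀ f g → f ⊛ g ≋ g ⊛ f
  ⊛-comm f g n = trans (Σ-reverse n (λ i → f i * g (n ∸ i)))
    (sumCount-cong-< 0 (suc n) (λ i _ i< →
      trans (*-comm _ _) (*-congʳ (≡⇒≈ (≡.cong g (ℕ.m∸[m∸n]≡n (ℕ.≤-pred i<)))))))

  ⊛-identityˡ : ∀ f → oneS ⊛ f ≋ f
  ⊛-identityˡ f n = begin
      1# * f n + sumCount 1 n (λ i → oneS i * f (n ∸ i))
    ≡⟨ ≡.cong (1# * f n +_) (sumCount-suc 0 n _) ⟩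
      1# * f n + sumCount 0 n (λ i → 0# * f (n ∸ suc i))
    ≈⟨ +-cong (*-identityˡ _) (trans (sumCount-cong 0 n (λ i → zeroˡ _)) (sumCount-zero 0 n)) ⟩
      f n + 0#
    ≈⟨ +-identityʳ _ ⟩
      f n
    ∎

  ⊛-identityʳ : ∀ f → f ⊛ oneS ≋ f
  ⊛-identityʳ f = ≋-trans (⊛-comm f oneS) (⊛-identityˡ f)

  ⊛-assoc : ∀ f g h → (f ⊛ g) ⊛ h ≋ f ⊛ (g ⊛ h)
  ⊛-assoc f g h n = begin
      Σ[ 0 ⋯ n ] (λ i → Σ[ 0 ⋯ i ] (λ a → f a * g (i ∸ a)) * h (n ∸ i))
    ≈⟨ sumCount-cong 0 (suc n) (λ i → *-distribʳ-sumCount 0 (suc i) (h (n ∸ i)) _) ⟩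
      Σ[ 0 ⋯ n ] (λ i → Σ[ 0 ⋯ i ] (λ a → (f a * g (i ∸ a)) * h (n ∸ i)))
    ≈⟨ Σ-triangle n (λ i a → (f a * g (i ∸ a)) * h (n ∸ i)) ⟩
      Σ[ 0 ⋯ n ] (λ a → Σ[ a ⋯ n ] (λ i → (f a * g (i ∸ a)) * h (n ∸ i)))
    ≈⟨ sumCount-cong-< 0 (suc n) (λ a _ a< → Σ-from-zero a n _ (ℕ.≤-pred a<)) ⟩
      Σ[ 0 ⋯ n ] (λ a → Σ[ 0 ⋯ n ∸ a ] (λ b → (f a * g ((a ℕ.+ b) ∸ a)) * h (n ∸ (a ℕ.+ b))))
    ≈⟨ sumCount-cong 0 (suc n) (λ a → sumCount-cong 0 (suc (n ∸ a)) (λ b →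
         trans (*-assoc _ _ _) (*-congˡ (*-cong (≡⇒≈ (≡.cong g (ℕ.m+n∸m≡n a b)))
                                                 (≡⇒≈ (≡.cong h (≡.sym (ℕ.∸-+-assoc n a b)))))))) ⟩
      Σ[ 0 ⋯ n ] (λ a → Σ[ 0 ⋯ n ∸ a ] (λ b → f a * (g b * h ((n ∸ a) ∸ b))))
    ≈⟨ sumCount-cong 0 (suc n) (λ a → sym (*-distribˡ-sumCount 0 (suc (n ∸ a)) (f a) _)) ⟩
      Σ[ 0 ⋯ n ] (λ a → f a * Σ[ 0 ⋯ n ∸ a ] (λ b → g b * h ((n ∸ a) ∸ b)))
    ∎

  ⊛-distribʳ-⊝ : ∀ f g h → (f ⊝ g) ⊛ h ≋ (f ⊛ h) ⊝ (g ⊛ h)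
  ⊛-distribʳ-⊝ f g h n = trans
    (sumCount-cong 0 (suc n) (λ i → trans (distribʳ _ _ _) (+-congˡ (sym (-‿distribˡ-* _ _)))))
    (sumCount-- 0 (suc n) _ _)

  expS-0# : expS 0# ≋ oneS
  expS-0# zero = trans (*-identityˡ _) ι-1⁻¹
  expS-0# (suc n) = trans (*-congʳ (zeroˡ _)) (zeroˡ _)

  ⊛-expS-0# : ∀ f → f ⊛ expS 0# ≋ f
  ⊛-expS-0# f = ≋-trans (⊛-cong (λ _ → refl) expS-0#) (⊛-identityʳ f)

  egfCoeff-cong : ∀ {f g} → f ≋ g → ∀ n → egfCoeff f n ≈ egfCoeff g n
  egfCoeff-cong f≋g n = *-congˡ (f≋g n)

  egfCoeff-⊛ : ∀ f g n → egfCoeff (f ⊛ g) n ≈ Σ[ 0 ⋯ n ] (λ l → binom n l * (egfCoeff f (n ∸ l) * egfCoeff g l))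
  egfCoeff-⊛ f g n = begin
      ι (n !) * Σ[ 0 ⋯ n ] (λ i → f i * g (n ∸ i))
    ≈⟨ *-distribˡ-sumCount 0 (suc n) _ _ ⟩
      Σ[ 0 ⋯ n ] (λ i → ι (n !) * (f i * g (n ∸ i)))
    ≈⟨ Σ-reverse n _ ⟩
      Σ[ 0 ⋯ n ] (λ l → ι (n !) * (f (n ∸ l) * g (n ∸ (n ∸ l))))
    ≈⟨ sumCount-cong-< 0 (suc n) (λ l _ l< → let l≤n = ℕ.≤-pred l< in
         trans (*-cong (ι!-split n l l≤n) (*-congˡ (≡⇒≈ (≡.cong g (ℕ.m∸[m∸n]≡n l≤n)))))
               (solve 5 (λ C A B p q → (C ⊕ (A ⊕ B)) ⊕ (p ⊕ q) ⊜ C ⊕ ((B ⊕ p) ⊕ (A ⊕ q))) refl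
                  (binom n l) (ι (l !)) (ι ((n ∸ l) !)) (f (n ∸ l)) (g l))) ⟩
      Σ[ 0 ⋯ n ] (λ l → binom n l * (egfCoeff f (n ∸ l) * egfCoeff g l))
    ∎

  egfCoeff-⊝ : ∀ f g n → egfCoeff (f ⊝ g) n ≈ egfCoeff f n - egfCoeff g n
  egfCoeff-⊝ f g n = trans (distribˡ _ _ _) (+-congˡ (sym (-‿distribʳ-* _ _)))

  egfCoeff-expS : ∀ a n → egfCoeff (expS a) n ≈ a ^ n
  egfCoeff-expS a n = ι!-cancelˡ n (a ^ n)

  egfCoeff-⊛-expS : ∀ f y n → egfCoeff (f ⊛ expS y) n ≈ Σ[ 0 ⋯ n ] (λ l → binom n l * (egfCoeff f (n ∸ l) * y ^ l))
  egfCoeff-⊛-expS f y n =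
    trans (egfCoeff-⊛ f (expS y) n) (sumCount-cong 0 (suc n) (λ l → *-congˡ (*-congˡ (egfCoeff-expS y l))))

  egfCoeff-⊛-at0 : ∀ f g n →
    egfCoeff (f ⊛ g) n ≈ Σ[ 0 ⋯ n ] (λ l → binom n l * (egfCoeff (f ⊛ expS 0#) (n ∸ l) * egfCoeff g l))
  egfCoeff-⊛-at0 f g n = trans (egfCoeff-⊛ f g n)
    (sumCount-cong 0 (suc n) (λ l → *-congˡ (*-congʳ (sym (egfCoeff-cong (⊛-expS-0# f) (n ∸ l))))))

  -- The series u = 1 - e^{-t} and w = e^t - 1

  uS-0 : uS 0 ≈ 0#
  uS-0 = trans (+-congˡ (-‿cong (trans (*-identityˡ _) ι-1⁻¹))) (-‿inverseʳ 1#)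

  powS-uS-vanishes : ∀ m i → i ℕ.< m → powS uS m i ≈ 0#
  powS-uS-vanishes (suc m) i (s≤s i≤m) = begin
      uS 0 * powS uS m i + sumCount 1 i (λ a → uS a * powS uS m (i ∸ a))
    ≈⟨ +-cong (trans (*-congʳ uS-0) (zeroˡ _))
              (trans (sumCount-cong-< 1 i (λ a 1≤a a< → trans (*-congˡ (powS-uS-vanishes m (i ∸ a)
                       (ℕ.<-≤-trans (ℕ.∸-monoʳ-< {i} {a} {0} 1≤a (ℕ.≤-pred a<)) i≤m))) (zeroʳ _)))
                     (sumCount-zero 1 i)) ⟩
      0# + 0#
    ≈⟨ +-identityʳ 0# ⟩
      0#
    ∎

  wS : PowerSeries
  wS = expS 1# ⊝ oneS

  uS≈-[-1]^a*wS : ∀ a → uS a ≈ (- 1#) * ((- 1#) ^ a * wS a)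
  uS≈-[-1]^a*wS zero = trans uS-0 (sym (trans (*-congˡ (trans (*-identityˡ _) wS-0)) (zeroʳ _)))
    where
    wS-0 : wS 0 ≈ 0#
    wS-0 = trans (+-congʳ (trans (*-identityˡ _) ι-1⁻¹)) (-‿inverseʳ 1#)
  uS≈-[-1]^a*wS (suc a) = trans (+-identityˡ _) (trans (-‿cong (*-congˡ (sym wS-suc))) (sym (-1*x≈-x _)))
    where
    wS-suc : wS (suc a) ≈ ι (suc a !) ⁻¹
    wS-suc = trans (+-congˡ -0#≈0#) (trans (+-identityʳ _) (trans (*-congʳ (1^n≈1 (suc a))) (*-identityˡ _)))

  powS-uS≈±powS-wS : ∀ m N → powS uS m N ≈ (- 1#) ^ m * ((- 1#) ^ N * powS wS m N)
  powS-uS≈±powS-wS zero zero = sym (trans (*-identityˡ _) (*-identityˡ _))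
  powS-uS≈±powS-wS zero (suc N) = sym (trans (*-identityˡ _) (zeroʳ _))
  powS-uS≈±powS-wS (suc m) N = begin
      Σ[ 0 ⋯ N ] (λ a → uS a * powS uS m (N ∸ a))
    ≈⟨ sumCount-cong-< 0 (suc N) (λ a _ a< → trans (*-cong (uS≈-[-1]^a*wS a) (powS-uS≈±powS-wS m (N ∸ a)))
         (trans (solve 6 (λ o s wa p t W → (o ⊕ (s ⊕ wa)) ⊕ (p ⊕ (t ⊕ W)) ⊜ (o ⊕ p) ⊕ ((s ⊕ t) ⊕ (wa ⊕ W))) refl
                  (- 1#) ((- 1#) ^ a) (wS a) ((- 1#) ^ m) ((- 1#) ^ (N ∸ a)) (powS wS m (N ∸ a)))
                (*-congˡ (*-congʳ ([-1]^a*[-1]^[n∸a] a N (ℕ.≤-pred a<)))))) ⟩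
      Σ[ 0 ⋯ N ] (λ a → (- 1#) ^ suc m * ((- 1#) ^ N * (wS a * powS wS m (N ∸ a))))
    ≈⟨ sym (*-distribˡ-sumCount 0 (suc N) _ _) ⟩
      (- 1#) ^ suc m * Σ[ 0 ⋯ N ] (λ a → (- 1#) ^ N * (wS a * powS wS m (N ∸ a)))
    ≈⟨ *-congˡ (sym (*-distribˡ-sumCount 0 (suc N) _ _)) ⟩
      (- 1#) ^ suc m * ((- 1#) ^ N * powS wS (suc m) N)
    ∎

  egfCoeff-powS-uS : ∀ m N → m ℕ.≤ N → egfCoeff (powS uS m) N ≈ (- 1#) ^ (N ∸ m) * (ι (m !) * S₂ N m)
  egfCoeff-powS-uS m N m≤N = begin
      ι (N !) * powS uS m N
    ≈⟨ *-congˡ (powS-uS≈±powS-wS m N) ⟩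
      ι (N !) * (s * ((- 1#) ^ N * W))
    ≈⟨ *-congˡ (*-congˡ (*-congʳ (sym ([-1]^a*[-1]^[n∸a] m N m≤N)))) ⟩
      ι (N !) * (s * ((s * t) * W))
    ≈⟨ solve 4 (λ q s t W → q ⊕ (s ⊕ ((s ⊕ t) ⊕ W)) ⊜ (s ⊕ s) ⊕ (t ⊕ (q ⊕ W))) refl (ι (N !)) s t W ⟩
      (s * s) * (t * (ι (N !) * W))
    ≈⟨ trans (*-congʳ ([-1]^n*[-1]^n≈1 m)) (*-identityˡ _) ⟩
      t * (ι (N !) * W)
    ≈⟨ *-congˡ (sym (trans (sym (*-assoc _ _ _)) (trans (*-congʳ (ι-inverseʳ (m !) (ℕ.1≤n! m))) (*-identityˡ _)))) ⟩
      t * (ι (m !) * S₂ N m)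
    ∎
    where
    s = (- 1#) ^ m
    t = (- 1#) ^ (N ∸ m)
    W = powS wS m N

  ∇ : ℕ → Carrier → ℕ → Carrier
  ∇ m x l = Σ[ 0 ⋯ m ] (λ j → (- 1#) ^ j * (binom m j * (x - ι j) ^ l))

  ∇-zero : ∀ x l → ∇ 0 x l ≈ x ^ l
  ∇-zero x l = trans (+-identityʳ _) (trans (*-identityˡ _)
    (trans (*-cong ι-1 (^-cong l (trans (+-congˡ -0#≈0#) (+-identityʳ x)))) (*-identityˡ _)))

  ∇-suc : ∀ m x l → ∇ (suc m) x l ≈ ∇ m x l - Σ[ 0 ⋯ m ] (λ j → (- 1#) ^ j * (binom m j * (x - ι (suc j)) ^ l))
  ∇-suc m x l = begin
      ∇ (suc m) x l
    ≈⟨ sumCount-cong 0 (suc (suc m)) (λ j → swap12 _ _ _) ⟩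
      Σ[ 0 ⋯ suc m ] (λ j → binom (suc m) j * A j)
    ≈⟨ binomial-pascal m A ⟩
      Σ[ 0 ⋯ m ] (λ j → binom m j * A j) + Σ[ 0 ⋯ m ] (λ j → binom m j * A (suc j))
    ≈⟨ +-cong (sumCount-cong 0 (suc m) (λ j → swap12 _ _ _))
              (trans (sumCount-cong 0 (suc m) (λ j →
                        solve 4 (λ b o s y → b ⊕ ((o ⊕ s) ⊕ y) ⊜ o ⊕ (s ⊕ (b ⊕ y))) refl _ _ _ _))
                     (trans (sym (*-distribˡ-sumCount 0 (suc m) _ _)) (-1*x≈-x _))) ⟩
      ∇ m x l - Σ[ 0 ⋯ m ] (λ j → (- 1#) ^ j * (binom m j * (x - ι (suc j)) ^ l))
    ∎
    where
    A = λ j → (- 1#) ^ j * (x - ι j) ^ l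
    swap12 : ∀ a b d → a * (b * d) ≈ b * (a * d)
    swap12 = solve 3 (λ a b d → a ⊕ (b ⊕ d) ⊜ b ⊕ (a ⊕ d)) refl

  ∇-shift : ∀ m x l → Σ[ 0 ⋯ l ] (λ i → binom l i * ((- 1#) ^ (l ∸ i) * ∇ m x i))
                      ≈ Σ[ 0 ⋯ m ] (λ j → (- 1#) ^ j * (binom m j * (x - ι (suc j)) ^ l))
  ∇-shift m x l = begin
      Σ[ 0 ⋯ l ] (λ i → binom l i * ((- 1#) ^ (l ∸ i) * ∇ m x i))
    ≈⟨ sumCount-cong 0 (suc l) (λ i → trans (*-congˡ (*-distribˡ-sumCount 0 (suc m) _ _))
                                            (*-distribˡ-sumCount 0 (suc m) _ _)) ⟩
      Σ[ 0 ⋯ l ] (λ i → Σ[ 0 ⋯ m ] (λ j → binom l i * ((- 1#) ^ (l ∸ i) * ((- 1#) ^ j * (binom m j * (x - ι j) ^ i)))))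
    ≈⟨ sumCount-swap 0 (suc l) 0 (suc m) _ ⟩
      Σ[ 0 ⋯ m ] (λ j → Σ[ 0 ⋯ l ] (λ i → binom l i * ((- 1#) ^ (l ∸ i) * ((- 1#) ^ j * (binom m j * (x - ι j) ^ i)))))
    ≈⟨ sumCount-cong 0 (suc m) (λ j → trans (sumCount-cong 0 (suc l) (λ i →
         solve 5 (λ a b c d e → a ⊕ (b ⊕ (c ⊕ (d ⊕ e))) ⊜ c ⊕ (d ⊕ (a ⊕ (b ⊕ e)))) refl
           (binom l i) ((- 1#) ^ (l ∸ i)) ((- 1#) ^ j) (binom m j) ((x - ι j) ^ i)))
         (trans (sym (*-distribˡ-sumCount 0 (suc l) _ _)) (*-congˡ (sym (*-distribˡ-sumCount 0 (suc l) _ _))))) ⟩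
      Σ[ 0 ⋯ m ] (λ j → (- 1#) ^ j * (binom m j * Σ[ 0 ⋯ l ] (λ i → binom l i * ((- 1#) ^ (l ∸ i) * (x - ι j) ^ i))))
    ≈⟨ sumCount-cong 0 (suc m) (λ j → *-congˡ (*-congˡ
         (trans (sym (binomial-theorem l (x - ι j) (- 1#))) (^-cong l (x-j-1 j))))) ⟩
      Σ[ 0 ⋯ m ] (λ j → (- 1#) ^ j * (binom m j * (x - ι (suc j)) ^ l))
    ∎
    where
    x-j-1 : ∀ j → (x - ι j) + - 1# ≈ x - ι (suc j)
    x-j-1 j = trans (+-assoc _ _ _) (+-congˡ (trans (+-comm _ _) (-‿+-comm 1# (ι j))))

  egfCoeff-powS-uS⊛expS : ∀ m x l → egfCoeff (powS uS m ⊛ expS x) l ≈ ∇ m x l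
  egfCoeff-powS-uS⊛expS zero x l =
    trans (egfCoeff-cong (⊛-identityˡ (expS x)) l) (trans (egfCoeff-expS x l) (sym (∇-zero x l)))
  egfCoeff-powS-uS⊛expS (suc m) x l = begin
      egfCoeff ((uS ⊛ U) ⊛ expS x) l
    ≈⟨ egfCoeff-cong (≋-trans (⊛-assoc uS U (expS x)) (⊛-distribʳ-⊝ oneS (expS (- 1#)) G)) l ⟩
      egfCoeff ((oneS ⊛ G) ⊝ (expS (- 1#) ⊛ G)) l
    ≈⟨ egfCoeff-⊝ (oneS ⊛ G) (expS (- 1#) ⊛ G) l ⟩
      egfCoeff (oneS ⊛ G) l - egfCoeff (expS (- 1#) ⊛ G) l
    ≈⟨ +-cong (trans (egfCoeff-cong (⊛-identityˡ G) l) (egfCoeff-powS-uS⊛expS m x l))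
              (-‿cong (egfCoeff-⊛ (expS (- 1#)) G l)) ⟩
      ∇ m x l - Σ[ 0 ⋯ l ] (λ i → binom l i * (egfCoeff (expS (- 1#)) (l ∸ i) * egfCoeff G i))
    ≈⟨ +-congˡ (-‿cong (sumCount-cong 0 (suc l) (λ i →
         *-congˡ (*-cong (egfCoeff-expS (- 1#) (l ∸ i)) (egfCoeff-powS-uS⊛expS m x i))))) ⟩
      ∇ m x l - Σ[ 0 ⋯ l ] (λ i → binom l i * ((- 1#) ^ (l ∸ i) * ∇ m x i))
    ≈⟨ +-congˡ (-‿cong (∇-shift m x l)) ⟩
      ∇ m x l - Σ[ 0 ⋯ m ] (λ j → (- 1#) ^ j * (binom m j * (x - ι (suc j)) ^ l))
    ≈⟨ sym (∇-suc m x l) ⟩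
      ∇ (suc m) x l
    ∎
    where
    U = powS uS m
    G = U ⊛ expS x

  -- Poly-Bernoulli polynomials

  liCoeff : ℤ → ℕ → Carrier
  liCoeff k m = ι (suc m) ^ℤ (negℤ k)

  polyLiGF-pad : ∀ k i n → i ℕ.≤ n → polyLiGF k i ≈ Σ[ 0 ⋯ n ] (λ m → liCoeff k m * powS uS m i)
  polyLiGF-pad k i n i≤n =
    Σ-pad i n _ i≤n (λ m i<m _ → trans (*-congˡ (powS-uS-vanishes m i i<m)) (zeroʳ _))

  polyB≈Σ∇ : ∀ k x l n → l ℕ.≤ n → polyB k x l ≈ Σ[ 0 ⋯ n ] (λ m → liCoeff k m * ∇ m x l)
  polyB≈Σ∇ k x l n l≤n = begin
      ι (l !) * Σ[ 0 ⋯ l ] (λ i → polyLiGF k i * expS x (l ∸ i))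
    ≈⟨ *-congˡ (sumCount-cong-< 0 (suc l) (λ i _ i< →
         *-congʳ (polyLiGF-pad k i n (ℕ.≤-trans (ℕ.≤-pred i<) l≤n)))) ⟩
      ι (l !) * Σ[ 0 ⋯ l ] (λ i → Σ[ 0 ⋯ n ] (λ m → liCoeff k m * powS uS m i) * expS x (l ∸ i))
    ≈⟨ *-congˡ (sumCount-cong 0 (suc l) (λ i → *-distribʳ-sumCount 0 (suc n) _ _)) ⟩
      ι (l !) * Σ[ 0 ⋯ l ] (λ i → Σ[ 0 ⋯ n ] (λ m → (liCoeff k m * powS uS m i) * expS x (l ∸ i)))
    ≈⟨ *-congˡ (sumCount-swap 0 (suc l) 0 (suc n) _) ⟩
      ι (l !) * Σ[ 0 ⋯ n ] (λ m → Σ[ 0 ⋯ l ] (λ i → (liCoeff k m * powS uS m i) * expS x (l ∸ i)))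
    ≈⟨ *-congˡ (sumCount-cong 0 (suc n) (λ m → trans (sumCount-cong 0 (suc l) (λ i → *-assoc _ _ _))
                                                     (sym (*-distribˡ-sumCount 0 (suc l) _ _)))) ⟩
      ι (l !) * Σ[ 0 ⋯ n ] (λ m → liCoeff k m * (powS uS m ⊛ expS x) l)
    ≈⟨ *-distribˡ-sumCount 0 (suc n) _ _ ⟩
      Σ[ 0 ⋯ n ] (λ m → ι (l !) * (liCoeff k m * (powS uS m ⊛ expS x) l))
    ≈⟨ sumCount-cong 0 (suc n) (λ m → trans (solve 3 (λ a b d → a ⊕ (b ⊕ d) ⊜ b ⊕ (a ⊕ d)) refl _ _ _)
                                             (*-congˡ (egfCoeff-powS-uS⊛expS m x l))) ⟩
      Σ[ 0 ⋯ n ] (λ m → liCoeff k m * ∇ m x l)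
    ∎

  polyB0≈ΣS₂ : ∀ k N → polyB0 k N ≈ Σ[ 0 ⋯ N ] (λ m → liCoeff k m * ((- 1#) ^ (N ∸ m) * (ι (m !) * S₂ N m)))
  polyB0≈ΣS₂ k N = begin
      egfCoeff (polyLiGF k ⊛ expS 0#) N
    ≈⟨ egfCoeff-cong (⊛-expS-0# (polyLiGF k)) N ⟩
      ι (N !) * Σ[ 0 ⋯ N ] (λ m → liCoeff k m * powS uS m N)
    ≈⟨ *-distribˡ-sumCount 0 (suc N) _ _ ⟩
      Σ[ 0 ⋯ N ] (λ m → ι (N !) * (liCoeff k m * powS uS m N))
    ≈⟨ sumCount-cong-< 0 (suc N) (λ m _ m< → trans (solve 3 (λ a b d → a ⊕ (b ⊕ d) ⊜ b ⊕ (a ⊕ d)) refl _ _ _)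
                                                   (*-congˡ (egfCoeff-powS-uS m N (ℕ.≤-pred m<)))) ⟩
      Σ[ 0 ⋯ N ] (λ m → liCoeff k m * ((- 1#) ^ (N ∸ m) * (ι (m !) * S₂ N m)))
    ∎

  module _ {r} (as : Vec Carrier r) (k : ℤ) (x : Carrier) (n : ℕ) where
    private
      B  = barnesGF as
      Li = polyLiGF k
      E  = expS x

    S≈Σ-barnesB0-polyB : S[ as , k ] x n ≈ Σ[ 0 ⋯ n ] (λ l → binom n l * (barnesB0 as (n ∸ l) * polyB k x l))
    S≈Σ-barnesB0-polyB = trans (egfCoeff-cong (⊛-assoc B Li E) n) (egfCoeff-⊛-at0 B (Li ⊛ E) n)

    S≈Σ-polyB0-barnesB : S[ as , k ] x n ≈ Σ[ 0 ⋯ n ] (λ l → binom n l * (polyB0 k (n ∸ l) * barnesB as x l))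
    S≈Σ-polyB0-barnesB =
      trans (egfCoeff-cong (≋-trans (⊛-cong (⊛-comm B Li) (λ _ → refl)) (⊛-assoc Li B E)) n)
            (egfCoeff-⊛-at0 Li (B ⊛ E) n)

    S≈Σ-S0 : S[ as , k ] x n ≈ Σ[ 0 ⋯ n ] (λ j → binom n j * (S0[ as , k ] (n ∸ j) * (x ^ j)))
    S≈Σ-S0 = trans (egfCoeff-⊛-at0 (B ⊛ Li) E n)
                   (sumCount-cong 0 (suc n) (λ j → *-congˡ (*-congˡ (egfCoeff-expS x j))))

    S≈Σ∇ : S[ as , k ] x n ≈ Σ[ 0 ⋯ n ] (λ l → Σ[ 0 ⋯ n ] (λ m → Σ[ 0 ⋯ m ] (λ j →
             ((- 1#) ^ j) * (binom m j * (binom n l * ((ι (suc m) ^ℤ (negℤ k))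
               * (barnesB0 as (n ∸ l) * ((x - ι j) ^ l))))))))
    S≈Σ∇ = trans S≈Σ-barnesB0-polyB (sumCount-cong-< 0 (suc n) (λ l _ l< →
      trans (*-congˡ (*-congˡ (polyB≈Σ∇ k x l n (ℕ.≤-pred l<)))) (distribute l)))
      where
      distribute : ∀ l → binom n l * (barnesB0 as (n ∸ l) * Σ[ 0 ⋯ n ] (λ m → liCoeff k m * ∇ m x l))
                   ≈ Σ[ 0 ⋯ n ] (λ m → Σ[ 0 ⋯ m ] (λ j → ((- 1#) ^ j) * (binom m j * (binom n l
                       * (liCoeff k m * (barnesB0 as (n ∸ l) * ((x - ι j) ^ l)))))))
      distribute l = begin
          b * (B0 * Σ[ 0 ⋯ n ] (λ m → liCoeff k m * ∇ m x l))
        ≈⟨ trans (*-congˡ (*-distribˡ-sumCount 0 (suc n) _ _)) (*-distribˡ-sumCount 0 (suc n) _ _) ⟩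
          Σ[ 0 ⋯ n ] (λ m → b * (B0 * (liCoeff k m * ∇ m x l)))
        ≈⟨ sumCount-cong 0 (suc n) (λ m →
             trans (*-congˡ (*-congˡ (*-distribˡ-sumCount 0 (suc m) _ _)))
             (trans (*-congˡ (*-distribˡ-sumCount 0 (suc m) _ _)) (*-distribˡ-sumCount 0 (suc m) _ _))) ⟩
          Σ[ 0 ⋯ n ] (λ m → Σ[ 0 ⋯ m ] (λ j → b * (B0 * (liCoeff k m * ((- 1#) ^ j * (binom m j * (x - ι j) ^ l))))))
        ≈⟨ sumCount-cong 0 (suc n) (λ m → sumCount-cong 0 (suc m) (λ j →
             solve 6 (λ b B0 cm s bm Y → b ⊕ (B0 ⊕ (cm ⊕ (s ⊕ (bm ⊕ Y)))) ⊜ s ⊕ (bm ⊕ (b ⊕ (cm ⊕ (B0 ⊕ Y))))) refl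
               b B0 (liCoeff k m) ((- 1#) ^ j) (binom m j) ((x - ι j) ^ l))) ⟩
          Σ[ 0 ⋯ n ] (λ m → Σ[ 0 ⋯ m ] (λ j → ((- 1#) ^ j) * (binom m j * (b * (liCoeff k m * (B0 * ((x - ι j) ^ l)))))))
        ∎
        where
        b  = binom n l
        B0 = barnesB0 as (n ∸ l)

    S≈Σ-S₂ : S[ as , k ] x n ≈ Σ[ 0 ⋯ n ] (λ l → Σ[ l ⋯ n ] (λ j → Σ[ 0 ⋯ n ∸ j ] (λ m →
               ((- 1#) ^ ((n ∸ m) ∸ j)) * (binom n j * (binom j l * ((ι (m !) * (ι (suc m) ^ℤ (negℤ k)))
                 * (S₂ (n ∸ j) m * barnesB0 as (j ∸ l))))))) * (x ^ l))
    S≈Σ-S₂ = begin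
        S[ as , k ] x n
      ≈⟨ S≈Σ-polyB0-barnesB ⟩
        Σ[ 0 ⋯ n ] (λ j → binom n j * (polyB0 k (n ∸ j) * barnesB as x j))
      ≈⟨ sumCount-cong 0 (suc n) (λ j → trans (*-congˡ (*-congˡ (barnesB-expansion j)))
           (trans (*-congˡ (*-distribˡ-sumCount 0 (suc j) _ _)) (*-distribˡ-sumCount 0 (suc j) _ _))) ⟩
        Σ[ 0 ⋯ n ] (λ j → Σ[ 0 ⋯ j ] (λ l → binom n j * (polyB0 k (n ∸ j) * (binom j l * (barnesB0 as (j ∸ l) * x ^ l)))))
      ≈⟨ Σ-triangle n _ ⟩
        Σ[ 0 ⋯ n ] (λ l → Σ[ l ⋯ n ] (λ j → binom n j * (polyB0 k (n ∸ j) * (binom j l * (barnesB0 as (j ∸ l) * x ^ l)))))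
      ≈⟨ sumCount-cong 0 (suc n) (λ l → trans (sumCount-cong l (suc n ∸ l) (term l))
                                              (sym (*-distribʳ-sumCount l (suc n ∸ l) _ _))) ⟩
        Σ[ 0 ⋯ n ] (λ l → Σ[ l ⋯ n ] (λ j → Σ[ 0 ⋯ n ∸ j ] (T l j)) * (x ^ l))
      ∎
      where
      barnesB-expansion : ∀ j → barnesB as x j ≈ Σ[ 0 ⋯ j ] (λ l → binom j l * (barnesB0 as (j ∸ l) * x ^ l))
      barnesB-expansion j = trans (egfCoeff-⊛-at0 B E j)
        (sumCount-cong 0 (suc j) (λ l → *-congˡ (*-congˡ (egfCoeff-expS x l))))

      T : ℕ → ℕ → ℕ → Carrier
      T l j m = ((- 1#) ^ ((n ∸ m) ∸ j)) * (binom n j * (binom j l * ((ι (m !) * (ι (suc m) ^ℤ (negℤ k)))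
                  * (S₂ (n ∸ j) m * barnesB0 as (j ∸ l)))))

      ∸-comm : ∀ j m → (n ∸ j) ∸ m ≡ (n ∸ m) ∸ j
      ∸-comm j m = ≡.trans (ℕ.∸-+-assoc n j m)
        (≡.trans (≡.cong (n ∸_) (ℕ.+-comm j m)) (≡.sym (ℕ.∸-+-assoc n m j)))

      term : ∀ l j → binom n j * (polyB0 k (n ∸ j) * (binom j l * (barnesB0 as (j ∸ l) * x ^ l)))
                     ≈ Σ[ 0 ⋯ n ∸ j ] (T l j) * x ^ l
      term l j = begin
          binom n j * (polyB0 k (n ∸ j) * R)
        ≈⟨ *-congˡ (*-congʳ (polyB0≈ΣS₂ k (n ∸ j))) ⟩
          binom n j * (Σ[ 0 ⋯ n ∸ j ] V * R)
        ≈⟨ trans (*-congˡ (*-distribʳ-sumCount 0 (suc (n ∸ j)) R V)) (*-distribˡ-sumCount 0 (suc (n ∸ j)) _ _) ⟩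
          Σ[ 0 ⋯ n ∸ j ] (λ m → binom n j * (V m * R))
        ≈⟨ sumCount-cong 0 (suc (n ∸ j)) (λ m → trans
             (solve 8 (λ b cm sg f S bl B0 X → b ⊕ ((cm ⊕ (sg ⊕ (f ⊕ S))) ⊕ (bl ⊕ (B0 ⊕ X)))
                    ⊜ (sg ⊕ (b ⊕ (bl ⊕ ((f ⊕ cm) ⊕ (S ⊕ B0))))) ⊕ X) refl
                (binom n j) (liCoeff k m) ((- 1#) ^ ((n ∸ j) ∸ m)) (ι (m !)) (S₂ (n ∸ j) m)
                (binom j l) (barnesB0 as (j ∸ l)) (x ^ l))
             (*-congʳ (*-congʳ (≡⇒≈ (≡.cong ((- 1#) ^_) (∸-comm j m)))))) ⟩
          Σ[ 0 ⋯ n ∸ j ] (λ m → T l j m * x ^ l)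
        ≈⟨ sym (*-distribʳ-sumCount 0 (suc (n ∸ j)) _ _) ⟩
          Σ[ 0 ⋯ n ∸ j ] (T l j) * x ^ l
        ∎
        where
        R = binom j l * (barnesB0 as (j ∸ l) * x ^ l)
        V = λ m → liCoeff k m * ((- 1#) ^ ((n ∸ j) ∸ m) * (ι (m !) * S₂ (n ∸ j) m))

theorem1 : ∀ {c ℓ} (F : CharZeroField c ℓ) → let open CharZeroField F in let open Series F in
    (r : ℕ) (as : Vec Carrier (suc r)) → (∀ i → ¬ (lookup as i ≈ 0#)) →
    (k : ℤ) (x : Carrier) (n : ℕ) →
      (S[ as , k ] x n ≈ Σ[ 0 ⋯ n ] (λ l → binom n l * (barnesB0 as (n ∸ l) * polyB k x l)))
      × (S[ as , k ] x n ≈ Σ[ 0 ⋯ n ] (λ l → binom n l * (polyB0 k (n ∸ l) * barnesB as x l)))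
      × (S[ as , k ] x n ≈ Σ[ 0 ⋯ n ] (λ l → Σ[ 0 ⋯ n ] (λ m → Σ[ 0 ⋯ m ] (λ j →
            ((- 1#) ^ j) * (binom m j * (binom n l * ((ι (suc m) ^ℤ (negℤ k))
              * (barnesB0 as (n ∸ l) * ((x - ι j) ^ l)))))))))
      × (S[ as , k ] x n ≈ Σ[ 0 ⋯ n ] (λ l → Σ[ l ⋯ n ] (λ j → Σ[ 0 ⋯ n ∸ j ] (λ m →
            ((- 1#) ^ ((n ∸ m) ∸ j)) * (binom n j * (binom j l * ((ι (m !) * (ι (suc m) ^ℤ (negℤ k)))
              * (S₂ (n ∸ j) m * barnesB0 as (j ∸ l))))))) * (x ^ l)))
      × (S[ as , k ] x n ≈ Σ[ 0 ⋯ n ] (λ j → binom n j * (S0[ as , k ] (n ∸ j) * (x ^ j))))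
theorem1 F r as _ k x n =
  S≈Σ-barnesB0-polyB as k x n , S≈Σ-polyB0-barnesB as k x n , S≈Σ∇ as k x n ,
  S≈Σ-S₂ as k x n , S≈Σ-S0 as k x n
  where open SeriesIdentities F
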